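{- Let $r$ be an even positive integer and let $G$ be a finite $r$-regular graph (multiple edges allowed) on $n$ vertices which has the triangle property. Then $G$ contains at least $\frac{nr}{6}$ triangles.
   Context: Graphs may have multiple edges. A triangle in a graph is a set of three distinct vertices together with a choice of one edge joining each pair of them; thus if a pair of the three vertices is joined by a multiple edge, the same three vertices give rise to several distinct triangles, and a loop is never in a triangle. A graph has the triangle property if every edge of the graph lies in at least one triangle. -}

module Defs where

open import Data.Nat using (ℕ; _+_; _*_; _≤_; _<_)
open import Data.Fin using (Fin; toℕ; _≟_)
open import Data.List using (length; filter; allFin)
open import Data.Product using (Σ; _×_; _,_; proj₁; proj₂; ∃-syntax)
open import Data.Sum using (_⊎_)
open import Relation.Binary.PropositionalEquality using (_≡_; _≢_)
open import Function.Definitions using (Injective)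

record Multigraph : Set where
  field
    n    : ℕ
    m    : ℕ
    ends : Fin m → Fin n × Fin n

open Multigraph public

-- degree: number of edge-ends at v (a loop contributes 2)
degree : (G : Multigraph) → Fin (n G) → ℕ
degree G v =
  length (filter (λ e → proj₁ (ends G e) ≟ v) (allFin (m G)))
  + length (filter (λ e → proj₂ (ends G e) ≟ v) (allFin (m G)))

Regular : ℕ → Multigraph → Set
Regular r G = ∀ v → degree G v ≡ r

Joins : (G : Multigraph) → Fin (m G) → Fin (n G) → Fin (n G) → Set
Joins G e x y = ends G e ≡ (x , y) ⊎ ends G e ≡ (y , x)

IsTriangle : (G : Multigraph) → Fin (m G) → Fin (m G) → Fin (m G) → Set
IsTriangle G e₁ e₂ e₃ =
  ∃[ a ] ∃[ b ] ∃[ c ] (a ≢ b × b ≢ c × a ≢ c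
    × Joins G e₁ a b × Joins G e₂ b c × Joins G e₃ a c)

TriangleProperty : Multigraph → Set
TriangleProperty G = ∀ e → ∃[ f ] ∃[ g ] IsTriangle G e f g

-- A triangle is determined by its (3-element) set of edges; we represent it
-- canonically by its edges listed in increasing index order.
Triangle : Multigraph → Set
Triangle G = ∃[ e₁ ] ∃[ e₂ ] ∃[ e₃ ]
  (toℕ e₁ < toℕ e₂ × toℕ e₂ < toℕ e₃ × IsTriangle G e₁ e₂ e₃)

edgesOf : (G : Multigraph) → Triangle G → Fin (m G) × Fin (m G) × Fin (m G)
edgesOf G (e₁ , e₂ , e₃ , _) = e₁ , e₂ , e₃

AtLeastTriangles : ℕ → Multigraph → Set
AtLeastTriangles k G =
  Σ (Fin k → Triangle G) λ t → (Injective _≡_ _≡_ (λ (i : Fin k) → edgesOf G (t i)))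

-- Counting edge-ends vertex by vertex gives n r = 2 m.  Choose for every edge
-- a triangle containing it; each of the k distinct triangles so chosen contains
-- at most three edges, hence m ≤ 3 k and n r ≤ 6 k.
module Submission where

open import Defs
open import Data.Bool using (true; false; if_then_else_)
open import Data.Fin using (Fin; zero; suc; _<_; _≟_; combine)
open import Data.Fin.Properties using (<-cmp; combine-injective; injective⇒≤)
open import Data.List using (List; length; filter; allFin; tabulate; map; lookup; deduplicate)
open import Data.List.Membership.Propositional using (_∈_)
open import Data.List.Membership.Propositional.Properties
  using (∈-lookup; ∈-allFin; ∈-map⁺; ∈-map⁻; ∈-deduplicate⁻; ∈-deduplicate⁺)
open import Data.List.Relation.Unary.All as All using ()
open import Data.List.Relation.Unary.AllPairs using (_∷_)
open import Data.List.Relation.Unary.Any using (index)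
open import Data.List.Relation.Unary.Any.Properties using (lookup-index)
open import Data.List.Relation.Unary.Unique.Propositional using (Unique)
open import Data.List.Relation.Unary.Unique.DecPropositional.Properties using (deduplicate-!)
open import Data.Nat using (ℕ; zero; suc; _+_; _*_; _≤_; NonZero)
open import Data.Nat.Divisibility using (_∣_)
open import Data.Nat.Properties
  using (+-0-commutativeMonoid; ≤-trans; ≤-reflexive; *-identityʳ; *-comm; *-distribˡ-+; +-mono-≤; module ≤-Reasoning)
open import Data.Product using (Σ; ∃-syntax; _×_; _,_; proj₁; proj₂)
open import Data.Product.Properties using (,-injectiveˡ; ,-injectiveʳ; ≡-dec)
open import Data.Sum using (_⊎_; inj₁; inj₂)
open import Function using (_∘_; id)
open import Function.Definitions using (Injective)
open import Relation.Binary.Definitions using (DecidableEquality; tri<; tri≈; tri>)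
open import Relation.Binary.PropositionalEquality
  using (_≡_; _≢_; refl; sym; trans; cong; cong₂; module ≡-Reasoning)
open import Relation.Nullary using (Dec; does; ¬_; contradiction)
open import Relation.Unary using (Pred; Decidable)

open import Algebra.Properties.CommutativeMonoid.Sum +-0-commutativeMonoid
  using (sum-syntax; sum-cong-≗; sum-replicate-zero; ∑-comm; ∑-distrib-+)

indicator : ∀ {p} {P : Set p} → Dec P → ℕ
indicator P? = if does P? then 1 else 0

∑-const : ∀ n c → ∑[ i < n ] c ≡ n * c
∑-const zero    c = refl
∑-const (suc n) c = cong (c +_) (∑-const n c)

length-filter-tabulate : ∀ {a p} {A : Set a} {P : Pred A p} (P? : Decidable P) {m} (f : Fin m → A) →
  length (filter P? (tabulate f)) ≡ ∑[ i < m ] indicator (P? (f i))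
length-filter-tabulate P? {zero}  f = refl
length-filter-tabulate P? {suc m} f with does (P? (f zero))
... | true  = cong suc (length-filter-tabulate P? (f ∘ suc))
... | false = length-filter-tabulate P? (f ∘ suc)

∑-indicator-≟ : ∀ {n} (a : Fin n) → ∑[ v < n ] indicator (a ≟ v) ≡ 1
∑-indicator-≟ {suc n} zero    = cong suc (sum-replicate-zero n)
∑-indicator-≟ {suc n} (suc a) = ∑-indicator-≟ a

∑-fibre-sizes : ∀ {m n} (f : Fin m → Fin n) →
  ∑[ v < n ] length (filter (λ e → f e ≟ v) (allFin m)) ≡ m
∑-fibre-sizes {m} {n} f = begin
  ∑[ v < n ] length (filter (λ e → f e ≟ v) (allFin m))
    ≡⟨ sum-cong-≗ (λ v → length-filter-tabulate (λ e → f e ≟ v) id) ⟩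
  ∑[ v < n ] ∑[ e < m ] indicator (f e ≟ v)
    ≡⟨ ∑-comm (λ v e → indicator (f e ≟ v)) ⟩
  ∑[ e < m ] ∑[ v < n ] indicator (f e ≟ v)
    ≡⟨ sum-cong-≗ (∑-indicator-≟ ∘ f) ⟩
  ∑[ e < m ] 1
    ≡⟨ ∑-const m 1 ⟩
  m * 1
    ≡⟨ *-identityʳ m ⟩
  m ∎
  where open ≡-Reasoning

handshake : ∀ {r} (G : Multigraph) → Regular r G → n G * r ≡ m G + m G
handshake {r} G regular = begin
  n G * r                                  ≡⟨ ∑-const (n G) r ⟨
  ∑[ v < n G ] r                           ≡⟨ sum-cong-≗ (sym ∘ regular) ⟩
  ∑[ v < n G ] degree G v                  ≡⟨ ∑-distrib-+ (fibre-size proj₁) (fibre-size proj₂) ⟩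
  ∑[ v < n G ] fibre-size proj₁ v
    + ∑[ v < n G ] fibre-size proj₂ v      ≡⟨ cong₂ _+_ (∑-fibre-sizes (proj₁ ∘ ends G)) (∑-fibre-sizes (proj₂ ∘ ends G)) ⟩
  m G + m G                                ∎
  where
  open ≡-Reasoning
  fibre-size : (Fin (n G) × Fin (n G) → Fin (n G)) → Fin (n G) → ℕ
  fibre-size end v = length (filter (λ e → end (ends G e) ≟ v) (allFin (m G)))

Unique⇒lookup-injective : ∀ {a} {A : Set a} {xs : List A} → Unique xs → Injective _≡_ _≡_ (lookup xs)
Unique⇒lookup-injective (_ ∷ _)      {zero}  {zero}  _  = refl
Unique⇒lookup-injective (x∉xs ∷ _)   {zero}  {suc j} eq = contradiction eq (All.lookup x∉xs (∈-lookup j))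
Unique⇒lookup-injective (x∉xs ∷ _)   {suc i} {zero}  eq = contradiction (sym eq) (All.lookup x∉xs (∈-lookup i))
Unique⇒lookup-injective (_ ∷ unique) {suc i} {suc j} eq = cong suc (Unique⇒lookup-injective unique eq)

image-enumeration : ∀ {b} {B : Set b} → DecidableEquality B → ∀ {m} (f : Fin m → B) →
  ∃[ k ] Σ (Fin k → Fin m) λ rep → Injective _≡_ _≡_ (f ∘ rep) × (∀ e → ∃[ i ] f (rep i) ≡ f e)
image-enumeration {B = B} _≟B_ {m} f = length image , rep , rep-injective , rep-covers
  where
  image : List B
  image = deduplicate _≟B_ (map f (allFin m))

  rep-spec : ∀ i → ∃[ e ] lookup image i ≡ f e
  rep-spec i with ∈-map⁻ f (∈-deduplicate⁻ _≟B_ (map f (allFin m)) (∈-lookup i))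
  ... | e , _ , eq = e , eq

  rep : Fin (length image) → Fin m
  rep = proj₁ ∘ rep-spec

  rep-injective : Injective _≡_ _≡_ (f ∘ rep)
  rep-injective {i} {j} eq = Unique⇒lookup-injective (deduplicate-! _≟B_ (map f (allFin m)))
    (trans (proj₂ (rep-spec i)) (trans eq (sym (proj₂ (rep-spec j)))))

  rep-covers : ∀ e → ∃[ i ] f (rep i) ≡ f e
  rep-covers e = index fe∈image , trans (sym (proj₂ (rep-spec (index fe∈image)))) (sym (lookup-index fe∈image))
    where
    fe∈image : f e ∈ image
    fe∈image = ∈-deduplicate⁺ _≟B_ (∈-map⁺ f (∈-allFin e))

injective-pair⇒≤ : ∀ {m k c} (i : Fin m → Fin k) (p : Fin m → Fin c) →
  (∀ {e e′} → i e ≡ i e′ → p e ≡ p e′ → e ≡ e′) → m ≤ k * c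
injective-pair⇒≤ i p injective = injective⇒≤ λ {e} {e′} eq →
  let i≡ , p≡ = combine-injective (i e) (p e) (i e′) (p e′) eq in injective i≡ p≡

m≤k*3⇒m+m≤6*k : ∀ {m k} → m ≤ k * 3 → m + m ≤ 6 * k
m≤k*3⇒m+m≤6*k {m} {k} m≤k*3 = begin
  m + m           ≤⟨ +-mono-≤ m≤k*3 m≤k*3 ⟩
  k * 3 + k * 3   ≡⟨ *-distribˡ-+ k 3 3 ⟨
  k * 6           ≡⟨ *-comm k 6 ⟩
  6 * k           ∎
  where open ≤-Reasoning

component : ∀ {a} {A : Set a} → A × A × A → Fin 3 → A
component (x , _ , _) zero             = x
component (_ , y , _) (suc zero)       = y
component (_ , _ , z) (suc (suc zero)) = z

≢⇒<⊎> : ∀ {k} {i j : Fin k} → i ≢ j → i < j ⊎ j < i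
≢⇒<⊎> {i = i} {j} i≢j with <-cmp i j
... | tri< i<j _ _ = inj₁ i<j
... | tri≈ _ i≡j _ = contradiction i≡j i≢j
... | tri> _ _ j<i = inj₂ j<i

module _ (G : Multigraph) where

  _∈ᵗ_ : Fin (m G) → Triangle G → Set
  e ∈ᵗ t = ∃[ p ] component (edgesOf G t) p ≡ e

  Joins-sym : ∀ {e x y} → Joins G e x y → Joins G e y x
  Joins-sym (inj₁ p) = inj₂ p
  Joins-sym (inj₂ p) = inj₁ p

  ¬Joins-both : ∀ {e x y z} → x ≢ y → y ≢ z → x ≢ z → Joins G e x y → ¬ Joins G e y z
  ¬Joins-both x≢y y≢z x≢z (inj₁ p) (inj₁ q) = x≢y (,-injectiveˡ (trans (sym p) q))
  ¬Joins-both x≢y y≢z x≢z (inj₁ p) (inj₂ q) = x≢z (,-injectiveˡ (trans (sym p) q))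
  ¬Joins-both x≢y y≢z x≢z (inj₂ p) (inj₁ q) = x≢z (,-injectiveʳ (trans (sym p) q))
  ¬Joins-both x≢y y≢z x≢z (inj₂ p) (inj₂ q) = y≢z (,-injectiveˡ (trans (sym p) q))

  IsTriangle-swap₁₂ : ∀ {e f g} → IsTriangle G e f g → IsTriangle G f e g
  IsTriangle-swap₁₂ (a , b , c , a≢b , b≢c , a≢c , ab , bc , ac) =
    c , b , a , b≢c ∘ sym , a≢b ∘ sym , a≢c ∘ sym , Joins-sym bc , Joins-sym ab , Joins-sym ac

  IsTriangle-swap₂₃ : ∀ {e f g} → IsTriangle G e f g → IsTriangle G e g f
  IsTriangle-swap₂₃ (a , b , c , a≢b , b≢c , a≢c , ab , bc , ac) =
    b , a , c , a≢b ∘ sym , a≢c , b≢c , Joins-sym ab , ac , bc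

  IsTriangle⇒≢₁₂ : ∀ {e f g} → IsTriangle G e f g → e ≢ f
  IsTriangle⇒≢₁₂ (a , b , c , a≢b , b≢c , a≢c , ab , bc , _) refl = ¬Joins-both a≢b b≢c a≢c ab bc

  IsTriangle⇒≢₁₃ : ∀ {e f g} → IsTriangle G e f g → e ≢ g
  IsTriangle⇒≢₁₃ = IsTriangle⇒≢₁₂ ∘ IsTriangle-swap₂₃

  IsTriangle⇒≢₂₃ : ∀ {e f g} → IsTriangle G e f g → f ≢ g
  IsTriangle⇒≢₂₃ = IsTriangle⇒≢₁₂ ∘ IsTriangle-swap₂₃ ∘ IsTriangle-swap₁₂

  triangle-through : ∀ {e f g} → IsTriangle G e f g → Σ (Triangle G) (e ∈ᵗ_)
  triangle-through {e} {f} {g} T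
    with ≢⇒<⊎> (IsTriangle⇒≢₁₂ T) | ≢⇒<⊎> (IsTriangle⇒≢₂₃ T) | ≢⇒<⊎> (IsTriangle⇒≢₁₃ T)
  ... | inj₁ e<f | inj₁ f<g | _        = (e , f , g , e<f , f<g , T) , zero , refl
  ... | inj₁ e<f | inj₂ g<f | inj₁ e<g = (e , g , f , e<g , g<f , IsTriangle-swap₂₃ T) , zero , refl
  ... | inj₁ e<f | inj₂ g<f | inj₂ g<e =
    (g , e , f , g<e , e<f , IsTriangle-swap₁₂ (IsTriangle-swap₂₃ T)) , suc zero , refl
  ... | inj₂ f<e | inj₁ f<g | inj₁ e<g = (f , e , g , f<e , e<g , IsTriangle-swap₁₂ T) , suc zero , refl
  ... | inj₂ f<e | inj₁ f<g | inj₂ g<e =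
    (f , g , e , f<g , g<e , IsTriangle-swap₂₃ (IsTriangle-swap₁₂ T)) , suc (suc zero) , refl
  ... | inj₂ f<e | inj₂ g<f | _        =
    (g , f , e , g<f , f<e , IsTriangle-swap₂₃ (IsTriangle-swap₁₂ (IsTriangle-swap₂₃ T))) , suc (suc zero) , refl

  distinct-covering-triangles : (∀ e → Σ (Triangle G) (e ∈ᵗ_)) → ∃[ k ] (m G ≤ k * 3 × AtLeastTriangles k G)
  distinct-covering-triangles covering
    with image-enumeration (≡-dec _≟_ (≡-dec _≟_ _≟_)) (edgesOf G ∘ proj₁ ∘ covering)
  ... | k , rep , rep-injective , covers =
    k , injective-pair⇒≤ slot position same-slot⇒≡ , t ∘ rep , rep-injective
    where
    t : Fin (m G) → Triangle G
    t = proj₁ ∘ covering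

    e∈t : ∀ e → e ∈ᵗ t e
    e∈t = proj₂ ∘ covering

    slot : Fin (m G) → Fin k
    slot = proj₁ ∘ covers

    position : Fin (m G) → Fin 3
    position = proj₁ ∘ e∈t

    same-triangle : ∀ {e e′} → slot e ≡ slot e′ → edgesOf G (t e) ≡ edgesOf G (t e′)
    same-triangle {e} {e′} s≡ =
      trans (sym (proj₂ (covers e))) (trans (cong (edgesOf G ∘ t ∘ rep) s≡) (proj₂ (covers e′)))

    same-slot⇒≡ : ∀ {e e′} → slot e ≡ slot e′ → position e ≡ position e′ → e ≡ e′
    same-slot⇒≡ {e} {e′} s≡ p≡ = begin
      e                                          ≡⟨ proj₂ (e∈t e) ⟨
      component (edgesOf G (t e)) (position e)   ≡⟨ cong₂ component (same-triangle s≡) p≡ ⟩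
      component (edgesOf G (t e′)) (position e′) ≡⟨ proj₂ (e∈t e′) ⟩
      e′                                         ∎
      where open ≡-Reasoning

theorem1 : (r : ℕ) → .{{_ : NonZero r}} → 2 ∣ r → (G : Multigraph) →
    Regular r G → TriangleProperty G →
    ∃[ k ] (n G * r ≤ 6 * k × AtLeastTriangles k G)
theorem1 r _ G regular triangle-property =
  let k , m≤k*3 , triangles =
        distinct-covering-triangles G (λ e → triangle-through G (proj₂ (proj₂ (triangle-property e))))
  in k , ≤-trans (≤-reflexive (handshake G regular)) (m≤k*3⇒m+m≤6*k {k = k} m≤k*3) , triangles
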